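{- For any pair of trees $T,\tilde T\in B^0_k(G)$ with $\mathcal{P}(T,k)=\mathcal{P}(\tilde T,k)$, the BUD walk on $B^0_k(G)$ can transition from $T$ to $\tilde T$ in at most $n-1$ steps, where $n=|V(G)|$; that is, there is a sequence of at most $n-1$ positive-probability BUD transitions from $T$ to $\tilde T$.
   Context: $G$ is a connected graph with vertex populations $p:V(G)\to\mathbb{R}^+$; $k\ge2$. $B^0_k(G)$ is the set of spanning trees $T$ of $G$ containing $k-1$ edges whose removal partitions $G$ into $k$ connected components each of population exactly $p(G)/k$; this set of $k-1$ edges is unique, and $\mathcal{P}(T,k)$ denotes the resulting partition of $V(G)$ into $k$ parts. The BUD walk on $B^0_k(G)$: from $T$, add a uniformly random edge of $E(G)\setminus E(T)$, creating a unique cycle $C$, then remove a uniformly random edge of $C$ among those whose removal yields a tree in $B^0_k(G)$.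
   Formalization: The vertex populations take values in the positive rationals instead of the positive reals. -}

module Defs where

open import Data.Nat as ℕ using (ℕ; zero; suc; _∸_; _<ᵇ_)
open import Data.Fin as Fin using (Fin; toℕ; _≟_)
open import Data.Bool using (Bool; true; false; _∧_; _∨_; not; if_then_else_)
open import Data.List using (List; []; _∷_; length)
open import Data.List.Relation.Unary.Unique.Propositional using (Unique)
open import Data.Integer using (+_)
open import Data.Rational as ℚ using (ℚ; 0ℚ; _/_)
open import Data.Product using (Σ; _×_; _,_; proj₁)
open import Data.Sum using (_⊎_)
open import Data.Unit using (⊤)
open import Relation.Nullary using (¬_)
open import Relation.Nullary.Decidable using (⌊_⌋)
open import Relation.Binary.PropositionalEquality using (_≡_)
open import Function.Bundles using (_⇔_)

-- Vertices are Fin n.  An edge set is a Bool-valued adjacency function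
-- (undirected: required to be symmetric where relevant).
EdgeSet : ℕ → Set
EdgeSet n = Fin n → Fin n → Bool

module _ {n : ℕ} where

  Symmetric : EdgeSet n → Set
  Symmetric E = ∀ u v → E u v ≡ E v u

  Loopless : EdgeSet n → Set
  Loopless E = ∀ u → E u u ≡ false

  _⊆E_ : EdgeSet n → EdgeSet n → Set
  E ⊆E F = ∀ u v → E u v ≡ true → F u v ≡ true

  _≈E_ : EdgeSet n → EdgeSet n → Set
  E ≈E F = ∀ u v → E u v ≡ F u v

  sameEdge : Fin n → Fin n → Fin n → Fin n → Bool
  sameEdge x y u v = (⌊ x ≟ u ⌋ ∧ ⌊ y ≟ v ⌋) ∨ (⌊ x ≟ v ⌋ ∧ ⌊ y ≟ u ⌋)

  addE : Fin n → Fin n → EdgeSet n → EdgeSet n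
  addE u v E x y = E x y ∨ sameEdge x y u v

  remE : Fin n → Fin n → EdgeSet n → EdgeSet n
  remE u v E x y = E x y ∧ not (sameEdge x y u v)

  _∖E_ : EdgeSet n → EdgeSet n → EdgeSet n
  (E ∖E S) x y = E x y ∧ not (S x y)

  data WalkE (E : EdgeSet n) : Fin n → Fin n → List (Fin n) → Set where
    here : ∀ {u} → WalkE E u u (u ∷ [])
    step : ∀ {u w v vs} → E u w ≡ true → WalkE E w v vs → WalkE E u v (u ∷ vs)

  Reach : EdgeSet n → Fin n → Fin n → Set
  Reach E u v = Σ (List (Fin n)) λ vs → WalkE E u v vs

  Connected : EdgeSet n → Set
  Connected E = ∀ u v → Reach E u v

  HasCycle : EdgeSet n → Set
  HasCycle E = Σ (Fin n) λ u → Σ (Fin n) λ v → Σ (List (Fin n)) λ vs →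
    WalkE E u v vs × Unique vs × (3 ℕ.≤ length vs) × E v u ≡ true

  Acyclic : EdgeSet n → Set
  Acyclic E = ¬ HasCycle E

  SpanningTree : EdgeSet n → EdgeSet n → Set
  SpanningTree G T = Symmetric T × T ⊆E G × Connected T × Acyclic T

  sumFin : ∀ {m} → (Fin m → ℕ) → ℕ
  sumFin {zero} f = 0
  sumFin {suc m} f = f Fin.zero ℕ.+ sumFin (λ i → f (Fin.suc i))

  edgeCount : EdgeSet n → ℕ
  edgeCount E = sumFin λ a → sumFin λ b →
    if (toℕ a <ᵇ toℕ b) ∧ E a b then 1 else 0

  sumℚ : ∀ {m} → (Fin m → ℚ) → ℚ
  sumℚ {zero} f = 0ℚ
  sumℚ {suc m} f = f Fin.zero ℚ.+ sumℚ (λ i → f (Fin.suc i))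

  pop : (Fin n → ℚ) → (Fin n → Bool) → ℚ
  pop p C = sumℚ λ w → if C w then p w else 0ℚ

  popTotal : (Fin n → ℚ) → ℚ
  popTotal p = sumℚ p

  -- S is a set of k−1 edges of T whose removal leaves components each of
  -- population exactly p(G)/k  (written k · p(C) = p(G))
  BalancedCut : (p : Fin n → ℚ) (k : ℕ) → EdgeSet n → EdgeSet n → Set
  BalancedCut p k T S =
    Symmetric S × S ⊆E T × edgeCount S ≡ k ∸ 1 ×
    (∀ v → Σ (Fin n → Bool) λ C →
       (∀ w → (C w ≡ true) ⇔ Reach (T ∖E S) v w) ×
       ((+ k / 1) ℚ.* pop p C ≡ popTotal p))

  B0 : (G : EdgeSet n) (p : Fin n → ℚ) (k : ℕ) → EdgeSet n → Set
  B0 G p k T = SpanningTree G T × Σ (EdgeSet n) λ S → BalancedCut p k T S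

  cutOf : ∀ G p k T → B0 G p k T → EdgeSet n
  cutOf G p k T (_ , S , _) = S

  -- 𝒫(T,k) = 𝒫(T̃,k): the components of T − S and T̃ − S̃ coincide
  SamePartition : ∀ G p k T T̃ → B0 G p k T → B0 G p k T̃ → Set
  SamePartition G p k T T̃ b b̃ =
    ∀ u v → Reach (T ∖E cutOf G p k T b) u v ⇔ Reach (T̃ ∖E cutOf G p k T̃ b̃) u v

  UsesEdge : Fin n → Fin n → List (Fin n) → Set
  UsesEdge a b [] = Data.Empty.⊥
    where import Data.Empty
  UsesEdge a b (x ∷ []) = Data.Empty.⊥
    where import Data.Empty
  UsesEdge a b (x ∷ y ∷ r) = (sameEdge a b x y ≡ true) ⊎ UsesEdge a b (y ∷ r)

  -- {a,b} lies on the unique cycle of T + {u,v}  ({u,v} ∉ T):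
  -- either it is {u,v} itself or it lies on the T-path from u to v
  OnCycle : EdgeSet n → Fin n → Fin n → Fin n → Fin n → Set
  OnCycle T u v a b = (sameEdge a b u v ≡ true) ⊎
    Σ (List (Fin n)) λ vs → WalkE T u v vs × Unique vs × UsesEdge a b vs

  -- a positive-probability BUD transition T → T'
  BUDStep : (G : EdgeSet n) (p : Fin n → ℚ) (k : ℕ) → EdgeSet n → EdgeSet n → Set
  BUDStep G p k T T' =
    Σ (Fin n) λ u → Σ (Fin n) λ v → G u v ≡ true × T u v ≡ false ×
    Σ (Fin n) λ a → Σ (Fin n) λ b → OnCycle T u v a b ×
    T' ≈E remE a b (addE u v T) × B0 G p k T'

  data BUDSteps (G : EdgeSet n) (p : Fin n → ℚ) (k : ℕ) : ℕ → EdgeSet n → EdgeSet n → Set where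
    done : ∀ {T T'} → T ≈E T' → BUDSteps G p k 0 T T'
    next : ∀ {m T T₁ T'} → BUDStep G p k T T₁ → BUDSteps G p k m T₁ T' → BUDSteps G p k (suc m) T T'

{-# OPTIONS --safe #-}
-- Root T̃ at a vertex r; every other vertex x has a parent edge x–parent(x) in T̃. While T lacks some
-- parent edge vw, one BUD step adds vw and removes an edge ab ∉ T̃ of the cycle it closes: if v and w
-- lie in one part, ab is taken inside that part and the cut is unchanged; otherwise vw is a cut edge
-- of T̃, ab is a cut edge of T, and vw replaces ab in the cut. Such a step keeps the partition and every
-- edge T shares with T̃, so the number of missing parent edges, at most n − 1, strictly decreases. When
-- none is missing, T = T̃: in an acyclic graph containing all parent edges, every edge is a parent edge.

module Submission where

open import Defs
open import Data.Nat as ℕ using (ℕ; zero; suc; _+_; _∸_; _≤_; _<_; s≤s; z≤n; _<ᵇ_)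
open import Data.Nat.Properties using (+-suc; suc-injective; <-cmp; <-asym; <ᵇ⇒<; <⇒<ᵇ; ≤-refl; ≤-trans; ≤-pred; ≮⇒≥)
open import Data.Nat.Induction using (<-wellFounded)
open import Induction.WellFounded using (Acc; acc)
open import Data.Fin using (Fin; zero; suc; toℕ; _≟_)
open import Data.Fin.Properties as Fin using (any?; toℕ-injective)
open import Data.Bool as Bool using (Bool; true; false; _∧_; _∨_; not; if_then_else_)
open import Data.Bool.Properties using (∧-conicalˡ; ∧-conicalʳ; ∨-zeroʳ; ∨-identityʳ; ∧-zeroʳ; ∧-identityʳ; not-injective; not-involutive; T-≡)
open import Data.List using (List; []; _∷_; length)
open import Data.List.Membership.Propositional using (_∈_; _∉_)
open import Data.List.Relation.Unary.Any using (here; there)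
open import Data.List.Relation.Unary.All using ([]; _∷_)
open import Data.List.Relation.Unary.All.Properties using (¬Any⇒All¬; All¬⇒¬Any)
open import Data.List.Relation.Unary.Unique.Propositional using (Unique)
open import Data.List.Relation.Unary.Unique.Propositional.Properties using (Unique[x∷xs]⇒x∉xs)
open import Data.List.Relation.Unary.AllPairs using ([]; _∷_)
import Data.List.Membership.DecPropositional as DecMembership
open import Data.Product using (Σ; _×_; _,_; proj₁; proj₂)
open import Data.Sum using (_⊎_; inj₁; inj₂; [_,_]′)
open import Relation.Nullary using (¬_; ¬?; Dec; yes; no; does; contradiction)
open import Relation.Nullary.Decidable using (_×-dec_; _⊎-dec_; isYes≗does; dec-true; dec-false; does-⇔)
open import Relation.Binary.PropositionalEquality using (_≡_; _≢_; refl; sym; trans; cong; cong₂; subst; module ≡-Reasoning)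
open import Function.Base using (_∘_)
open import Function.Bundles using (_⇔_; mk⇔; Equivalence)
open import Function.Construct.Composition using (_⇔-∘_)
open import Function.Construct.Symmetry using (⇔-sym)
open import Data.Rational as ℚ using (ℚ; 0ℚ)
open import Data.Fin.Subset using (Subset; ∣_∣; Empty) renaming (_∈_ to _∈ₛ_; _∉_ to _∉ₛ_; _⊆_ to _⊆ₛ_)
open import Data.Fin.Subset.Properties using (p⊂q⇒∣p∣<∣q∣; ∣⊤∣≡n; ∈⊤; nonempty?)
open import Data.Vec using (tabulate)
open import Data.Vec.Properties using (lookup∘tabulate; []=⇒lookup; lookup⇒[]=)
open import Relation.Binary.Definitions using (tri<; tri≈; tri>)

true≢false : true ≢ false
true≢false ()

does⇒ : ∀ {A : Set} (a? : Dec A) → does a? ≡ true → A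
does⇒ (yes a) _ = a

-- Unordered edges and edge sets

module _ {n : ℕ} where

  SameEdge : Fin n → Fin n → Fin n → Fin n → Set
  SameEdge x y u v = (x ≡ u × y ≡ v) ⊎ (x ≡ v × y ≡ u)

  sameEdge? : ∀ x y u v → Dec (SameEdge x y u v)
  sameEdge? x y u v = (x ≟ u ×-dec y ≟ v) ⊎-dec (x ≟ v ×-dec y ≟ u)

  sameEdge≡does : ∀ x y u v → sameEdge x y u v ≡ does (sameEdge? x y u v)
  sameEdge≡does x y u v =
    cong₂ _∨_ (cong₂ _∧_ (isYes≗does (x ≟ u)) (isYes≗does (y ≟ v)))
              (cong₂ _∧_ (isYes≗does (x ≟ v)) (isYes≗does (y ≟ u)))

  sameEdge-true : ∀ {x y u v} → SameEdge x y u v → sameEdge x y u v ≡ true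
  sameEdge-true {x} {y} {u} {v} s = trans (sameEdge≡does x y u v) (dec-true (sameEdge? x y u v) s)

  sameEdge-false : ∀ {x y u v} → ¬ SameEdge x y u v → sameEdge x y u v ≡ false
  sameEdge-false {x} {y} {u} {v} ¬s = trans (sameEdge≡does x y u v) (dec-false (sameEdge? x y u v) ¬s)

  sameEdge-true⁻ : ∀ {x y u v} → sameEdge x y u v ≡ true → SameEdge x y u v
  sameEdge-true⁻ {x} {y} {u} {v} eq = does⇒ (sameEdge? x y u v) (trans (sym (sameEdge≡does x y u v)) eq)

  sameEdge-refl : ∀ x y → sameEdge x y x y ≡ true
  sameEdge-refl x y = sameEdge-true {x} {y} {x} {y} (inj₁ (refl , refl))

  SameEdge-swapˡ : ∀ {x y u v} → SameEdge x y u v → SameEdge y x u v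
  SameEdge-swapˡ (inj₁ (p , q)) = inj₂ (q , p)
  SameEdge-swapˡ (inj₂ (p , q)) = inj₁ (q , p)

  SameEdge-swapʳ : ∀ {x y u v} → SameEdge x y u v → SameEdge x y v u
  SameEdge-swapʳ (inj₁ p) = inj₂ p
  SameEdge-swapʳ (inj₂ p) = inj₁ p

  SameEdge-sym : ∀ {x y u v} → SameEdge x y u v → SameEdge u v x y
  SameEdge-sym (inj₁ (refl , refl)) = inj₁ (refl , refl)
  SameEdge-sym (inj₂ (refl , refl)) = inj₂ (refl , refl)

  SameEdge-trans : ∀ {x y z t u v} → SameEdge x y u v → SameEdge z t u v → SameEdge x y z t
  SameEdge-trans (inj₁ (refl , refl)) s = SameEdge-sym s
  SameEdge-trans (inj₂ (refl , refl)) s = SameEdge-sym (SameEdge-swapʳ s)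

  sameEdge-swapˡ : ∀ x y u v → sameEdge x y u v ≡ sameEdge y x u v
  sameEdge-swapˡ x y u v = begin
    sameEdge x y u v            ≡⟨ sameEdge≡does x y u v ⟩
    does (sameEdge? x y u v)    ≡⟨ does-⇔ (mk⇔ SameEdge-swapˡ SameEdge-swapˡ) (sameEdge? x y u v) (sameEdge? y x u v) ⟩
    does (sameEdge? y x u v)    ≡⟨ sym (sameEdge≡does y x u v) ⟩
    sameEdge y x u v            ∎
    where open ≡-Reasoning

  SameEdge-cong : ∀ {E : EdgeSet n} → Symmetric E → ∀ {x y u v} → SameEdge x y u v → E x y ≡ E u v
  SameEdge-cong symE (inj₁ (refl , refl)) = refl
  SameEdge-cong symE (inj₂ (refl , refl)) = symE _ _

  edge≢nonEdge : ∀ {E : EdgeSet n} → Symmetric E → ∀ {x y u v} → E x y ≡ true → E u v ≡ false → ¬ SameEdge x y u v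
  edge≢nonEdge symE exy ¬euv s = true≢false (trans (sym exy) (trans (SameEdge-cong symE s) ¬euv))

  module _ (E : EdgeSet n) {x y : Fin n} where

    addE⁻ : ∀ {u v} → addE u v E x y ≡ true → E x y ≡ true ⊎ SameEdge x y u v
    addE⁻ eq with E x y
    ... | true = inj₁ refl
    ... | false = inj₂ (sameEdge-true⁻ eq)

    addE⁺ˡ : ∀ {u v} → E x y ≡ true → addE u v E x y ≡ true
    addE⁺ˡ e = cong (_∨ _) e

    addE⁺ʳ : ∀ {u v} → SameEdge x y u v → addE u v E x y ≡ true
    addE⁺ʳ s = trans (cong (E x y ∨_) (sameEdge-true s)) (∨-zeroʳ (E x y))

    remE⁻ : ∀ {a b} → remE a b E x y ≡ true → E x y ≡ true × ¬ SameEdge x y a b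
    remE⁻ eq = ∧-conicalˡ _ _ eq ,
               λ s → true≢false (trans (sym (sameEdge-true s)) (not-injective (∧-conicalʳ _ _ eq)))

    remE⁺ : ∀ {a b} → E x y ≡ true → ¬ SameEdge x y a b → remE a b E x y ≡ true
    remE⁺ e ¬s = cong₂ _∧_ e (cong not (sameEdge-false ¬s))

    ∖E⁻ : ∀ S → (E ∖E S) x y ≡ true → E x y ≡ true × S x y ≡ false
    ∖E⁻ S eq = ∧-conicalˡ _ _ eq , not-injective (∧-conicalʳ _ _ eq)

    ∖E⁺ : ∀ S → E x y ≡ true → S x y ≡ false → (E ∖E S) x y ≡ true
    ∖E⁺ S e s = cong₂ _∧_ e (cong not s)

  addE-sym : ∀ {E : EdgeSet n} u v → Symmetric E → Symmetric (addE u v E)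
  addE-sym u v symE x y = cong₂ _∨_ (symE x y) (sameEdge-swapˡ x y u v)

  remE-sym : ∀ {E : EdgeSet n} a b → Symmetric E → Symmetric (remE a b E)
  remE-sym a b symE x y = cong₂ _∧_ (symE x y) (cong not (sameEdge-swapˡ x y a b))

  ∖E-sym : ∀ {E S : EdgeSet n} → Symmetric E → Symmetric S → Symmetric (E ∖E S)
  ∖E-sym symE symS x y = cong₂ _∧_ (symE x y) (cong not (symS x y))

  _⊆E-trans_ : ∀ {E F H : EdgeSet n} → E ⊆E F → F ⊆E H → E ⊆E H
  (E⊆F ⊆E-trans F⊆H) x y e = F⊆H x y (E⊆F x y e)

  remE-⊆ : ∀ {E : EdgeSet n} a b → remE a b E ⊆E E
  remE-⊆ {E} a b x y e = proj₁ (remE⁻ E e)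

  remE-mono : ∀ {E F : EdgeSet n} a b → E ⊆E F → remE a b E ⊆E remE a b F
  remE-mono {E} {F} a b E⊆F x y e = let (exy , ¬s) = remE⁻ E e in remE⁺ F (E⊆F x y exy) ¬s

  remE-comm : ∀ {E : EdgeSet n} a b c d → remE a b (remE c d E) ⊆E remE c d (remE a b E)
  remE-comm {E} a b c d x y e =
    let (e₁ , ¬ab) = remE⁻ (remE c d E) e ; (e₂ , ¬cd) = remE⁻ E e₁ in remE⁺ (remE a b E) (remE⁺ E e₂ ¬ab) ¬cd

  remE-cong : ∀ {E : EdgeSet n} {a b c d} → SameEdge a b c d → remE a b E ⊆E remE c d E
  remE-cong {E} s x y e = let (exy , ¬s) = remE⁻ E e in remE⁺ E exy λ s′ → ¬s (SameEdge-trans s′ s)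

  addE-mono : ∀ {E F : EdgeSet n} u v → E ⊆E F → addE u v E ⊆E addE u v F
  addE-mono {E} {F} u v E⊆F x y e with addE⁻ E e
  ... | inj₁ exy = addE⁺ˡ F (E⊆F x y exy)
  ... | inj₂ s = addE⁺ʳ F s

  exchange⁺ : ∀ (E : EdgeSet n) {v w a b x y} → E x y ≡ true → ¬ SameEdge x y a b → remE a b (addE v w E) x y ≡ true
  exchange⁺ E exy ¬ab = remE⁺ (addE _ _ E) (addE⁺ˡ E exy) ¬ab

  exchange⁻ : ∀ (E : EdgeSet n) {v w a b x y} → remE a b (addE v w E) x y ≡ true → ¬ SameEdge x y v w →
              E x y ≡ true × ¬ SameEdge x y a b
  exchange⁻ E e ¬vw with remE⁻ (addE _ _ E) e
  ... | e′ , ¬ab with addE⁻ E e′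
  ...   | inj₁ exy = exy , ¬ab
  ...   | inj₂ vw = contradiction vw ¬vw

  exchange-new : ∀ {E : EdgeSet n} {v w a b} → Symmetric E → E v w ≡ false → E a b ≡ true →
                 remE a b (addE v w E) v w ≡ true
  exchange-new {E} symE Evw Eab =
    remE⁺ (addE _ _ E) (addE⁺ʳ E (inj₁ (refl , refl))) (edge≢nonEdge symE Eab Evw ∘ SameEdge-sym)

  ⊆-antisym : ∀ {E F : EdgeSet n} → E ⊆E F → F ⊆E E → E ≈E F
  ⊆-antisym {E} {F} E⊆F F⊆E x y with E x y in Exy | F x y in Fxy
  ... | true | true = refl
  ... | false | false = refl
  ... | true | false = contradiction (trans (sym (E⊆F x y Exy)) Fxy) true≢false
  ... | false | true = contradiction (trans (sym (F⊆E x y Fxy)) Exy) true≢false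

  ∖E-⊆ : ∀ {E S : EdgeSet n} → (E ∖E S) ⊆E E
  ∖E-⊆ {E} {S} x y e = proj₁ (∖E⁻ E S e)

  ⊆-loopless : ∀ {E F : EdgeSet n} → E ⊆E F → Loopless F → Loopless E
  ⊆-loopless {E} E⊆F llF x with E x x in exx
  ... | true = contradiction (trans (sym (E⊆F x x exx)) (llF x)) true≢false
  ... | false = refl

  -- Walks, paths and cycles

  Reach-refl : ∀ {E : EdgeSet n} {u} → Reach E u u
  Reach-refl = _ , here

  Reach-edge : ∀ {E : EdgeSet n} {u v} → E u v ≡ true → Reach E u v
  Reach-edge e = _ , step e here

  Reach-trans : ∀ {E : EdgeSet n} {u v w} → Reach E u v → Reach E v w → Reach E u w
  Reach-trans (_ , here) r = r
  Reach-trans (_ , step e W) r = let (_ , W′) = Reach-trans (_ , W) r in _ , step e W′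

  Reach-sym : ∀ {E : EdgeSet n} → Symmetric E → ∀ {u v} → Reach E u v → Reach E v u
  Reach-sym symE (_ , here) = Reach-refl
  Reach-sym symE (_ , step {u} {w} e W) = Reach-trans (Reach-sym symE (_ , W)) (Reach-edge (trans (symE w u) e))

  Reach-bind : ∀ {E F : EdgeSet n} → (∀ x y → E x y ≡ true → Reach F x y) → ∀ {u v} → Reach E u v → Reach F u v
  Reach-bind h (_ , here) = Reach-refl
  Reach-bind h (_ , step e W) = Reach-trans (h _ _ e) (Reach-bind h (_ , W))

  Walk-mono : ∀ {E F : EdgeSet n} → E ⊆E F → ∀ {u v vs} → WalkE E u v vs → WalkE F u v vs
  Walk-mono E⊆F here = here
  Walk-mono E⊆F (step e W) = step (E⊆F _ _ e) (Walk-mono E⊆F W)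

  Reach-mono : ∀ {E F : EdgeSet n} → E ⊆E F → ∀ {u v} → Reach E u v → Reach F u v
  Reach-mono E⊆F (vs , W) = vs , Walk-mono E⊆F W

  ≈E⇒Reach⇔ : ∀ {E F : EdgeSet n} → E ≈E F → ∀ {u v} → Reach E u v ⇔ Reach F u v
  ≈E⇒Reach⇔ E≈F = mk⇔ (Reach-mono λ x y e → trans (sym (E≈F x y)) e) (Reach-mono λ x y e → trans (E≈F x y) e)

  Reach-reroute : ∀ {E F : EdgeSet n} {a b} → Symmetric F → remE a b E ⊆E F → Reach F a b →
                  ∀ {u v} → Reach E u v → Reach F u v
  Reach-reroute {E} {F} {a} {b} symF E-ab⊆F a⇝b = Reach-bind edge
    where
    edge : ∀ x y → E x y ≡ true → Reach F x y
    edge x y e with sameEdge? x y a b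
    ... | yes (inj₁ (refl , refl)) = a⇝b
    ... | yes (inj₂ (refl , refl)) = Reach-sym symF a⇝b
    ... | no ¬s = Reach-edge (E-ab⊆F x y (remE⁺ E e ¬s))

  -- A walk that crosses uv is cut at its last crossing.
  Reach-viaEdge : ∀ {E : EdgeSet n} u v {x y} → Reach E x y →
    Reach (remE u v E) x y ⊎
    (Reach (remE u v E) x u × Reach (remE u v E) v y) ⊎
    (Reach (remE u v E) x v × Reach (remE u v E) u y)
  Reach-viaEdge {E} u v (_ , here) = inj₁ Reach-refl
  Reach-viaEdge {E} u v (_ , step {x} {x₁} e W) with sameEdge? x x₁ u v | Reach-viaEdge u v (_ , W)
  ... | no ¬s | inj₁ r = inj₁ (Reach-trans (Reach-edge (remE⁺ E e ¬s)) r)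
  ... | no ¬s | inj₂ (inj₁ (r , r′)) = inj₂ (inj₁ (Reach-trans (Reach-edge (remE⁺ E e ¬s)) r , r′))
  ... | no ¬s | inj₂ (inj₂ (r , r′)) = inj₂ (inj₂ (Reach-trans (Reach-edge (remE⁺ E e ¬s)) r , r′))
  ... | yes (inj₁ (refl , refl)) | inj₁ r = inj₂ (inj₁ (Reach-refl , r))
  ... | yes (inj₁ (refl , refl)) | inj₂ (inj₁ (_ , r′)) = inj₂ (inj₁ (Reach-refl , r′))
  ... | yes (inj₁ (refl , refl)) | inj₂ (inj₂ (_ , r′)) = inj₁ r′
  ... | yes (inj₂ (refl , refl)) | inj₁ r = inj₂ (inj₂ (Reach-refl , r))
  ... | yes (inj₂ (refl , refl)) | inj₂ (inj₁ (_ , r′)) = inj₁ r′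
  ... | yes (inj₂ (refl , refl)) | inj₂ (inj₂ (_ , r′)) = inj₂ (inj₂ (Reach-refl , r′))

  Walk-head∈ : ∀ {E : EdgeSet n} {u v vs} → WalkE E u v vs → u ∈ vs
  Walk-head∈ here = here refl
  Walk-head∈ (step _ _) = here refl

  Walk-last∈ : ∀ {E : EdgeSet n} {u v vs} → WalkE E u v vs → v ∈ vs
  Walk-last∈ here = here refl
  Walk-last∈ (step _ W) = there (Walk-last∈ W)

  Walk-avoid : ∀ {E : EdgeSet n} {a b u v vs} → a ∉ vs → WalkE E u v vs → WalkE (remE a b E) u v vs
  Walk-avoid a∉vs here = here
  Walk-avoid {E} {a} {b} a∉vs (step {u} {w} e W) = step (remE⁺ E e ¬ab) (Walk-avoid (λ a∈ → a∉vs (there a∈)) W)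
    where
    ¬ab : ¬ SameEdge u w a b
    ¬ab (inj₁ (refl , _)) = a∉vs (here refl)
    ¬ab (inj₂ (_ , refl)) = a∉vs (there (Walk-head∈ W))

  Path : EdgeSet n → Fin n → Fin n → Set
  Path E u v = Σ (List (Fin n)) λ vs → WalkE E u v vs × Unique vs

  Path-suffix : ∀ {E : EdgeSet n} {u v vs x} → WalkE E u v vs → Unique vs → x ∈ vs → Path E x v
  Path-suffix here U (here refl) = _ , here , U
  Path-suffix (step e W) U (here refl) = _ , step e W , U
  Path-suffix (step _ W) (_ ∷ U) (there x∈) = Path-suffix W U x∈

  Reach⇒Path : ∀ {E : EdgeSet n} {u v} → Reach E u v → Path E u v
  Reach⇒Path (_ , here) = _ , here , [] ∷ []
  Reach⇒Path {u = u} (_ , step e W) with Reach⇒Path (_ , W)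
  ... | ws , W′ , U with DecMembership._∈?_ _≟_ u ws
  ...   | yes u∈ws = Path-suffix W′ U u∈ws
  ...   | no u∉ws = u ∷ ws , step e W′ , ¬Any⇒All¬ ws u∉ws ∷ U

  CycleEdge : EdgeSet n → Fin n → Fin n → Set
  CycleEdge E x y = E x y ≡ true × Reach (remE x y E) x y

  CycleEdge⇒HasCycle : ∀ {E : EdgeSet n} → Symmetric E → Loopless E → ∀ {x y} → CycleEdge E x y → HasCycle E
  CycleEdge⇒HasCycle {E} symE llE {x} {y} (exy , x⇝y) with Reach⇒Path x⇝y
  ... | ws , W , U = x , y , ws , Walk-mono (remE-⊆ x y) W , U , long W , trans (symE y x) exy
    where
    long : ∀ {vs} → WalkE (remE x y E) x y vs → 3 ≤ length vs
    long here = contradiction (trans (sym exy) (llE x)) true≢false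
    long (step e here) = contradiction (inj₁ (refl , refl)) (proj₂ (remE⁻ E e))
    long (step _ (step _ here)) = s≤s (s≤s (s≤s z≤n))
    long (step _ (step _ (step _ _))) = s≤s (s≤s (s≤s z≤n))

  HasCycle⇒CycleEdge : ∀ {E : EdgeSet n} → Symmetric E → HasCycle E → Σ (Fin n) λ x → Σ (Fin n) λ y → CycleEdge E x y
  HasCycle⇒CycleEdge symE (u , v , _ , here , _ , s≤s () , _)
  HasCycle⇒CycleEdge {E} symE (u , v , _ , step {w = x₁} e W , u∉ ∷ U , long , evu) =
    u , v , trans (symE u v) evu , _ , step (remE⁺ E e first) (Walk-avoid (All¬⇒¬Any u∉) W)
    where
    notClosed : ∀ {ws} → WalkE E v v ws → Unique ws → ¬ (3 ≤ suc (length ws))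
    notClosed here _ (s≤s (s≤s ()))
    notClosed (step _ W′) U′ _ = Unique[x∷xs]⇒x∉xs U′ (Walk-last∈ W′)
    first : ¬ SameEdge u x₁ u v
    first (inj₁ (_ , refl)) = notClosed W U long
    first (inj₂ (_ , refl)) = All¬⇒¬Any u∉ (Walk-head∈ W)

  -- Exchanging an edge of a spanning tree

  -- In a tree: ab lies on the path from v to w, with a on the side of v.
  Traverses : EdgeSet n → Fin n → Fin n → Fin n → Fin n → Set
  Traverses E v w a b = E a b ≡ true × Reach (remE a b E) v a × Reach (remE a b E) b w

  Traverses-mono : ∀ {E F : EdgeSet n} {v w a b} → E ⊆E F → Traverses E v w a b → Traverses F v w a b
  Traverses-mono {a = a} {b} E⊆F (eab , v⇝a , b⇝w) =
    E⊆F a b eab , Reach-mono (remE-mono a b E⊆F) v⇝a , Reach-mono (remE-mono a b E⊆F) b⇝w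

  Traverses-bypass : ∀ {E F : EdgeSet n} {v w a b} → Symmetric F → remE a b E ⊆E F → Reach F v w →
                     Traverses E v w a b → Reach F a b
  Traverses-bypass symF E-ab⊆F v⇝w (_ , v⇝a , b⇝w) =
    Reach-trans (Reach-sym symF (Reach-mono E-ab⊆F v⇝a)) (Reach-trans v⇝w (Reach-sym symF (Reach-mono E-ab⊆F b⇝w)))

  UsesEdge-∈ : ∀ {a b} vs → UsesEdge a b vs → a ∈ vs × b ∈ vs
  UsesEdge-∈ {a} {b} (x ∷ y ∷ r) (inj₁ s) with sameEdge-true⁻ {a} {b} {x} {y} s
  ... | inj₁ (refl , refl) = here refl , there (here refl)
  ... | inj₂ (refl , refl) = there (here refl) , here refl
  UsesEdge-∈ (x ∷ y ∷ r) (inj₂ u) = let (a∈ , b∈) = UsesEdge-∈ (y ∷ r) u in there a∈ , there b∈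

  UsesEdge-first : ∀ {E : EdgeSet n} {v x w ws} → WalkE E x w ws → UsesEdge v x (v ∷ ws)
  UsesEdge-first {v = v} {x} here = inj₁ (sameEdge-refl v x)
  UsesEdge-first {v = v} {x} (step _ _) = inj₁ (sameEdge-refl v x)

  UsesEdge-∷ : ∀ {E : EdgeSet n} {a b v x w ws} → WalkE E x w ws → UsesEdge a b ws → UsesEdge a b (v ∷ ws)
  UsesEdge-∷ here ()
  UsesEdge-∷ (step _ _) u = inj₂ u

  findEdge : ∀ {E : EdgeSet n} (Q : Fin n → Fin n → Bool) {v w vs} → WalkE E v w vs → Unique vs →
    Reach (λ x y → E x y ∧ not (Q x y)) v w ⊎
    Σ (Fin n) λ a → Σ (Fin n) λ b → Q a b ≡ true × UsesEdge a b vs × Traverses E v w a b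
  findEdge Q here _ = inj₁ Reach-refl
  findEdge {E} Q (step {v} {x} e W) (v∉ ∷ U) with Q v x in qvx
  ... | true = inj₂ (v , x , qvx , UsesEdge-first W , e , Reach-refl , (_ , Walk-avoid (All¬⇒¬Any v∉) W))
  ... | false with findEdge Q W U
  ...   | inj₁ x⇝w = inj₁ (Reach-trans (Reach-edge (cong₂ _∧_ e (cong not qvx))) x⇝w)
  ...   | inj₂ (a , b , q , uses , eab , x⇝a , b⇝w) =
          inj₂ (a , b , q , UsesEdge-∷ W uses , eab , Reach-trans (Reach-edge (remE⁺ E e ¬ab)) x⇝a , b⇝w)
    where
    ¬ab : ¬ SameEdge v x a b
    ¬ab (inj₁ (refl , _)) = All¬⇒¬Any v∉ (proj₁ (UsesEdge-∈ _ uses))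
    ¬ab (inj₂ (refl , _)) = All¬⇒¬Any v∉ (proj₂ (UsesEdge-∈ _ uses))

  exchange-spanningTree : ∀ {G T : EdgeSet n} {v w a b} → Symmetric G → Loopless G → SpanningTree G T →
    G v w ≡ true → T v w ≡ false → Traverses T v w a b → SpanningTree G (remE a b (addE v w T))
  exchange-spanningTree {G} {T} {v} {w} {a} {b} symG llG (symT , T⊆G , connT , acT) gvw tvw trav@(tab , _) =
    symT′ , T′⊆G , connT′ , acT′
    where
    T′ = remE a b (addE v w T)
    llT = ⊆-loopless T⊆G llG
    symT′ = remE-sym a b (addE-sym v w symT)
    symT-ab = remE-sym a b symT

    T′⊆G : T′ ⊆E G
    T′⊆G = remE-⊆ a b ⊆E-trans λ x y e → [ T⊆G x y , (λ s → trans (SameEdge-cong symG s) gvw) ]′ (addE⁻ T e)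

    T-ab⊆T′ : remE a b T ⊆E T′
    T-ab⊆T′ x y e = let (exy , ¬ab) = remE⁻ T e in exchange⁺ T exy ¬ab

    T′-vw⊆T-ab : remE v w T′ ⊆E remE a b T
    T′-vw⊆T-ab x y e = let (e′ , ¬vw) = remE⁻ T′ e ; (exy , ¬ab) = exchange⁻ T e′ ¬vw in remE⁺ T exy ¬ab

    viaT-ab : ∀ x y {s t} → Reach (remE v w (remE x y T′)) s t → Reach (remE a b T) s t
    viaT-ab x y = Reach-mono (remE-comm v w x y ⊆E-trans (remE-⊆ x y ⊆E-trans T′-vw⊆T-ab))

    connT′ : Connected T′
    connT′ x y = Reach-reroute symT′ T-ab⊆T′ a⇝b (connT x y)
      where a⇝b = Traverses-bypass symT′ T-ab⊆T′ (Reach-edge (exchange-new symT tvw tab)) trav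

    ¬v⇝w : ¬ Reach (remE a b T) v w
    ¬v⇝w v⇝w = acT (CycleEdge⇒HasCycle symT llT (tab , Traverses-bypass symT-ab (λ _ _ e → e) v⇝w trav))

    -- A cycle through an old edge xy either avoids vw, and so is a cycle of T,
    -- or passes through vw, and then joins v to w in T − ab.
    oldEdge-noCycle : ∀ {x y} → remE a b T x y ≡ true → ¬ Reach (remE x y T′) x y
    oldEdge-noCycle {x} {y} xy x⇝y with Reach-viaEdge v w x⇝y
    ... | inj₁ r = acT (CycleEdge⇒HasCycle symT llT (remE-⊆ {E = T} a b x y xy , Reach-mono outer r))
      where
      outer : remE v w (remE x y T′) ⊆E remE x y T
      outer = remE-comm v w x y ⊆E-trans remE-mono x y (T′-vw⊆T-ab ⊆E-trans remE-⊆ a b)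
    ... | inj₂ (inj₁ (x⇝v , w⇝y)) = ¬v⇝w (Reach-trans (Reach-sym symT-ab (viaT-ab x y x⇝v))
                                          (Reach-trans (Reach-edge xy) (Reach-sym symT-ab (viaT-ab x y w⇝y))))
    ... | inj₂ (inj₂ (x⇝w , v⇝y)) = ¬v⇝w (Reach-trans (viaT-ab x y v⇝y)
                                          (Reach-trans (Reach-edge (trans (symT-ab y x) xy)) (viaT-ab x y x⇝w)))

    acT′ : Acyclic T′
    acT′ cycle with HasCycle⇒CycleEdge symT′ cycle
    ... | x , y , T′xy , x⇝y with sameEdge? x y v w
    ...   | yes s@(inj₁ (refl , refl)) = ¬v⇝w (Reach-mono (remE-cong s ⊆E-trans T′-vw⊆T-ab) x⇝y)
    ...   | yes s@(inj₂ (refl , refl)) = ¬v⇝w (Reach-sym symT-ab (Reach-mono (remE-cong s ⊆E-trans T′-vw⊆T-ab) x⇝y))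
    ...   | no ¬vw = let (txy , ¬ab) = exchange⁻ T T′xy ¬vw in oldEdge-noCycle (remE⁺ T txy ¬ab) x⇝y

  -- Counting edges

  addE-elsewhere : ∀ (E : EdgeSet n) {u v x y} → ¬ SameEdge x y u v → addE u v E x y ≡ E x y
  addE-elsewhere E {x = x} {y} ¬s = trans (cong (E x y ∨_) (sameEdge-false ¬s)) (∨-identityʳ (E x y))

  remE-elsewhere : ∀ (E : EdgeSet n) {a b x y} → ¬ SameEdge x y a b → remE a b E x y ≡ E x y
  remE-elsewhere E {x = x} {y} ¬s = trans (cong (λ s → E x y ∧ not s) (sameEdge-false ¬s)) (∧-identityʳ (E x y))

  remE-removes : ∀ (E : EdgeSet n) a b → remE a b E a b ≡ false
  remE-removes E a b = trans (cong (λ s → E a b ∧ not s) (sameEdge-refl a b)) (∧-zeroʳ (E a b))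

  -- sumFin also takes, as an unused implicit argument, the vertex count of its module in Defs.
  sumFin-cong : ∀ {m} {f g : Fin m → ℕ} → (∀ i → f i ≡ g i) → sumFin {n} f ≡ sumFin {n} g
  sumFin-cong {zero} f≗g = refl
  sumFin-cong {suc m} f≗g = cong₂ _+_ (f≗g zero) (sumFin-cong (λ i → f≗g (suc i)))

  sumFin-suc-at : ∀ {m} {f g : Fin m → ℕ} i → g i ≡ suc (f i) → (∀ j → j ≢ i → g j ≡ f j) →
                  sumFin {n} g ≡ suc (sumFin {n} f)
  sumFin-suc-at {suc m} zero gi rest = cong₂ _+_ gi (sumFin-cong (λ j → rest (suc j) λ ()))
  sumFin-suc-at {suc m} {f} (suc i) gi rest =
    trans (cong₂ _+_ (rest zero λ ()) (sumFin-suc-at i gi λ j j≢i → rest (suc j) (j≢i ∘ Fin.suc-injective)))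
          (+-suc (f zero) _)

  ordered : ∀ (a b : Fin n) → a ≢ b → Σ (Fin n) λ lo → Σ (Fin n) λ hi → toℕ lo < toℕ hi × SameEdge lo hi a b
  ordered a b a≢b with <-cmp (toℕ a) (toℕ b)
  ... | tri< a<b _ _ = a , b , a<b , inj₁ (refl , refl)
  ... | tri≈ _ a≡b _ = contradiction (toℕ-injective a≡b) a≢b
  ... | tri> _ _ b<a = b , a , b<a , inj₂ (refl , refl)

  -- edgeCount counts an edge once, at its ordered pair lo < hi; a new edge changes only that summand.
  edgeCount-insert : ∀ {E E′ : EdgeSet n} {a b} → Symmetric E → Symmetric E′ → a ≢ b →
    E a b ≡ false → E′ a b ≡ true → (∀ x y → ¬ SameEdge x y a b → E′ x y ≡ E x y) →
    edgeCount E′ ≡ suc (edgeCount E)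
  edgeCount-insert {E} {E′} {a} {b} symE symE′ a≢b Eab E′ab elsewhere with ordered a b a≢b
  ... | lo , hi , lo<hi , s =
    sumFin-suc-at lo (sumFin-suc-at hi atEdge (λ y y≢hi → offEdge lo y λ (_ , y≡hi) → y≢hi y≡hi))
                     (λ x x≢lo → sumFin-cong λ y → offEdge x y λ (x≡lo , _) → x≢lo x≡lo)
    where
    counted : EdgeSet n → Fin n → Fin n → ℕ
    counted F x y = if (toℕ x <ᵇ toℕ y) ∧ F x y then 1 else 0
    atEdge : counted E′ lo hi ≡ suc (counted E lo hi)
    atEdge rewrite Equivalence.to T-≡ (<⇒<ᵇ lo<hi)
                 | trans (SameEdge-cong symE s) Eab | trans (SameEdge-cong symE′ s) E′ab = refl
    offEdge : ∀ x y → ¬ (x ≡ lo × y ≡ hi) → counted E′ x y ≡ counted E x y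
    offEdge x y ¬lohi with toℕ x <ᵇ toℕ y in x<ᵇy
    ... | false = refl
    ... | true = cong (if_then 1 else 0) (elsewhere x y ¬ab)
      where
      ¬ab : ¬ SameEdge x y a b
      ¬ab s′ with SameEdge-trans s′ s
      ... | inj₁ lohi = ¬lohi lohi
      ... | inj₂ (refl , refl) = <-asym lo<hi (<ᵇ⇒< (toℕ x) (toℕ y) (Equivalence.from T-≡ x<ᵇy))

  edgeCount-exchange : ∀ {S : EdgeSet n} {v w a b} → Symmetric S → v ≢ w → a ≢ b →
    S v w ≡ false → S a b ≡ true → edgeCount (remE a b (addE v w S)) ≡ edgeCount S
  edgeCount-exchange {S} {v} {w} {a} {b} symS v≢w a≢b Svw Sab = suc-injective (begin
    suc (edgeCount (remE a b S+vw)) ≡⟨ edgeCount-insert (remE-sym a b symS+vw) symS+vw a≢b (remE-removes S+vw a b)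
                                          (addE⁺ˡ S Sab) (λ x y ¬s → sym (remE-elsewhere S+vw ¬s)) ⟨
    edgeCount S+vw                 ≡⟨ edgeCount-insert symS symS+vw v≢w Svw (addE⁺ʳ S (inj₁ (refl , refl)))
                                          (λ x y ¬s → addE-elsewhere S ¬s) ⟩
    suc (edgeCount S)              ∎)
    where
    open ≡-Reasoning
    S+vw = addE v w S
    symS+vw = addE-sym v w symS

  exchange-∖E : ∀ {T S : EdgeSet n} {v w a b} → Symmetric T → Symmetric S → T v w ≡ false → S a b ≡ true →
    (remE a b (addE v w T) ∖E remE a b (addE v w S)) ≈E (T ∖E S)
  exchange-∖E {T} {S} {v} {w} {a} {b} symT symS Tvw Sab x y =
    identity (T x y) (S x y) (sameEdge x y v w) (sameEdge x y a b)
      (λ ab → trans (SameEdge-cong symS (sameEdge-true⁻ ab)) Sab)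
      (λ vw → trans (SameEdge-cong symT (sameEdge-true⁻ vw)) Tvw)
    where
    identity : ∀ t s e f → (f ≡ true → s ≡ true) → (e ≡ true → t ≡ false) →
               ((t ∨ e) ∧ not f) ∧ not ((s ∨ e) ∧ not f) ≡ t ∧ not s
    identity true  _     true  _     _  e⇒¬t = contradiction (e⇒¬t refl) true≢false
    identity true  true  false true  _  _    = refl
    identity true  true  false false _  _    = refl
    identity true  false false true  f⇒s _   = contradiction (f⇒s refl) (true≢false ∘ sym)
    identity true  false false false _  _    = refl
    identity false _     false _     _  _    = refl
    identity false _     true  true  _  _    = refl
    identity false true  true  false _  _    = refl
    identity false false true  false _  _    = refl

-- A BUD step towards T̃

module _ {n : ℕ} (p : Fin n → ℚ) (k : ℕ) where

  BalancedCut-transfer : ∀ {T S T′ S′ : EdgeSet n} → BalancedCut p k T S → Symmetric S′ → S′ ⊆E T′ →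
    edgeCount S′ ≡ edgeCount S → (∀ x y → Reach (T′ ∖E S′) x y ⇔ Reach (T ∖E S) x y) → BalancedCut p k T′ S′
  BalancedCut-transfer (_ , _ , count , parts) symS′ S′⊆T′ count′ sameParts =
    symS′ , S′⊆T′ , trans count′ count ,
    λ v → let (C , C⇔ , balanced) = parts v in C , (λ w → ⇔-sym (sameParts v w) ⇔-∘ C⇔ w) , balanced

module Towards {n : ℕ} {G : EdgeSet n} (symG : Symmetric G) (llG : Loopless G) {p : Fin n → ℚ} {k : ℕ}
  {T T̃ : EdgeSet n} (T∈B0 : B0 G p k T) (T̃∈B0 : B0 G p k T̃)
  (samePartition : SamePartition G p k T T̃ T∈B0 T̃∈B0) where

  private
    S = cutOf G p k T T∈B0
    S̃ = cutOf G p k T̃ T̃∈B0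
    symT = proj₁ (proj₁ T∈B0)
    connT = proj₁ (proj₂ (proj₂ (proj₁ T∈B0)))
    llT = ⊆-loopless (proj₁ (proj₂ (proj₁ T∈B0))) llG
    T̃⊆G = proj₁ (proj₂ (proj₁ T̃∈B0))
    symT̃ = proj₁ (proj₁ T̃∈B0)
    acT̃ = proj₂ (proj₂ (proj₂ (proj₁ T̃∈B0)))
    llT̃ = ⊆-loopless T̃⊆G llG
    cutT = proj₂ (proj₂ T∈B0)
    symS = proj₁ cutT
    S⊆T = proj₁ (proj₂ cutT)
    symS̃ = proj₁ (proj₂ (proj₂ T̃∈B0))

    nonEdge-cut : ∀ {x y} → T x y ≡ false → S x y ≡ false
    nonEdge-cut {x} {y} Txy with S x y in Sxy
    ... | true = contradiction (trans (sym (S⊆T x y Sxy)) Txy) true≢false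
    ... | false = refl

  record StepTowards (v w : Fin n) : Set where
    field
      T′ : EdgeSet n
      budStep : BUDStep G p k T T′
      T′∈B0 : B0 G p k T′
      samePartition′ : SamePartition G p k T′ T̃ T′∈B0 T̃∈B0
      keeps : ∀ x y → T x y ≡ true → T̃ x y ≡ true → T′ x y ≡ true
      gains : T′ v w ≡ true

  exchangeStep : ∀ {v w a b vs} → T̃ v w ≡ true → T v w ≡ false →
    WalkE T v w vs → Unique vs → UsesEdge a b vs → Traverses T v w a b → T̃ a b ≡ false →
    (S′ : EdgeSet n) → Symmetric S′ → S′ ⊆E remE a b (addE v w T) → edgeCount S′ ≡ edgeCount S →
    (∀ x y → Reach (remE a b (addE v w T) ∖E S′) x y ⇔ Reach (T ∖E S) x y) → StepTowards v w
  exchangeStep {v} {w} {a} {b} T̃vw Tvw P U uses trav T̃ab S′ symS′ S′⊆T′ count sameParts = record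
    { T′ = remE a b (addE v w T)
    ; budStep = v , w , gvw , Tvw , a , b , inj₂ (_ , P , U , uses) , (λ _ _ → refl) , T′∈B0
    ; T′∈B0 = T′∈B0
    ; samePartition′ = λ x y → samePartition x y ⇔-∘ sameParts x y
    ; keeps = λ x y Txy T̃xy → exchange⁺ T Txy (edge≢nonEdge symT̃ T̃xy T̃ab)
    ; gains = exchange-new symT Tvw (proj₁ trav)
    }
    where
    gvw = T̃⊆G v w T̃vw
    T′∈B0 = exchange-spanningTree symG llG (proj₁ T∈B0) gvw Tvw trav ,
            S′ , BalancedCut-transfer p k cutT symS′ S′⊆T′ count sameParts

  -- As T̃ is acyclic, some edge of the v–w path in T ∖ S lies outside T̃; exchanging it keeps the cut S.
  towardsWithinPart : ∀ {v w} → T̃ v w ≡ true → T v w ≡ false → Reach (T ∖E S) v w → StepTowards v w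
  towardsWithinPart {v} {w} T̃vw Tvw v⇝w with Reach⇒Path v⇝w
  ... | vs , P , U with findEdge (λ x y → not (T̃ x y)) P U
  ...   | inj₁ v⇝w-inT̃ = contradiction (CycleEdge⇒HasCycle symT̃ llT̃ (T̃vw , Reach-mono inT̃-vw v⇝w-inT̃)) acT̃
    where
    inT̃-vw : (λ x y → (T ∖E S) x y ∧ not (not (T̃ x y))) ⊆E remE v w T̃
    inT̃-vw x y e = remE⁺ T̃ (trans (sym (not-involutive _)) (∧-conicalʳ _ _ e))
                            (edge≢nonEdge symT (∖E-⊆ {E = T} {S} x y (∧-conicalˡ _ _ e)) Tvw)
  ...   | inj₂ (a , b , ¬T̃ab , uses , trav) =
    exchangeStep T̃vw Tvw (Walk-mono ∖E-⊆ P) U uses (Traverses-mono ∖E-⊆ trav) (not-injective ¬T̃ab)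
                 S symS S⊆T′ refl
                 λ x y → mk⇔ (Reach-reroute symT∖S T′∖S-vw⊆T∖S v⇝w) (Reach-reroute symT′∖S T∖S-ab⊆T′∖S a⇝b)
    where
    T′ = remE a b (addE v w T)
    symT∖S = ∖E-sym symT symS
    symT′∖S = ∖E-sym (remE-sym a b (addE-sym v w symT)) symS
    Sab : S a b ≡ false
    Sab = proj₂ (∖E⁻ T S (proj₁ trav))
    S⊆T′ : S ⊆E T′
    S⊆T′ x y Sxy = exchange⁺ T (S⊆T x y Sxy) (edge≢nonEdge symS Sxy Sab)
    T∖S-ab⊆T′∖S : remE a b (T ∖E S) ⊆E (T′ ∖E S)
    T∖S-ab⊆T′∖S x y e = let (e′ , ¬ab) = remE⁻ (T ∖E S) e ; (Txy , Sxy) = ∖E⁻ T S e′ in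
      ∖E⁺ T′ S (exchange⁺ T Txy ¬ab) Sxy
    T′∖S-vw⊆T∖S : remE v w (T′ ∖E S) ⊆E (T ∖E S)
    T′∖S-vw⊆T∖S x y e = let (e′ , ¬vw) = remE⁻ (T′ ∖E S) e ; (T′xy , Sxy) = ∖E⁻ T′ S e′ in
      ∖E⁺ T S (proj₁ (exchange⁻ T T′xy ¬vw)) Sxy
    a⇝b : Reach (T′ ∖E S) a b
    a⇝b = Traverses-bypass symT′∖S T∖S-ab⊆T′∖S (Reach-edge (∖E⁺ T′ S T′vw (nonEdge-cut Tvw))) trav
      where T′vw = exchange-new symT Tvw (∖E-⊆ {E = T} {S} a b (proj₁ trav))

  -- Now vw ∈ S̃, and some cut edge ab ∉ T̃ of T lies on the v–w path in T, so S + vw − ab is the new cut.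
  -- Otherwise every edge of that path would join its ends in T̃ − vw: a cut edge of T lying in T̃ directly,
  -- any other edge through its part, which T̃ ∖ S̃ connects.
  towardsAcrossParts : ∀ {v w} → T̃ v w ≡ true → T v w ≡ false → ¬ Reach (T ∖E S) v w → StepTowards v w
  towardsAcrossParts {v} {w} T̃vw Tvw ¬v⇝w with Reach⇒Path (connT v w)
  ... | vs , P , U with findEdge (λ x y → S x y ∧ not (T̃ x y)) P U
  ...   | inj₁ v⇝w-inT = contradiction (CycleEdge⇒HasCycle symT̃ llT̃ (T̃vw , Reach-bind viaT̃-vw v⇝w-inT)) acT̃
    where
    S̃vw : S̃ v w ≡ true
    S̃vw with S̃ v w in eq
    ... | true = refl
    ... | false = contradiction (Equivalence.from (samePartition v w) (Reach-edge (∖E⁺ T̃ S̃ T̃vw eq))) ¬v⇝w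
    T̃∖S̃⊆T̃-vw : (T̃ ∖E S̃) ⊆E remE v w T̃
    T̃∖S̃⊆T̃-vw x y e = let (T̃xy , S̃xy) = ∖E⁻ T̃ S̃ e in remE⁺ T̃ T̃xy (edge≢nonEdge symS̃ S̃vw S̃xy ∘ SameEdge-sym)
    viaT̃-vw : ∀ x y → (T x y ∧ not (S x y ∧ not (T̃ x y))) ≡ true → Reach (remE v w T̃) x y
    viaT̃-vw x y e with S x y in Sxy
    ... | true = Reach-edge (remE⁺ T̃ (trans (sym (not-involutive _)) (∧-conicalʳ _ _ e))
                                     (edge≢nonEdge symT (∧-conicalˡ _ _ e) Tvw))
    ... | false = Reach-mono T̃∖S̃⊆T̃-vw
                    (Equivalence.to (samePartition x y) (Reach-edge (∖E⁺ T S (∧-conicalˡ _ _ e) Sxy)))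
  ...   | inj₂ (a , b , SabT̃ab , uses , trav) =
    exchangeStep T̃vw Tvw P U uses trav T̃ab S′ (remE-sym a b (addE-sym v w symS)) (remE-mono a b (addE-mono v w S⊆T))
                 (edgeCount-exchange symS v≢w a≢b (nonEdge-cut Tvw) Sab)
                 λ x y → ≈E⇒Reach⇔ (exchange-∖E symT symS Tvw Sab)
    where
    S′ = remE a b (addE v w S)
    Sab = ∧-conicalˡ _ _ SabT̃ab
    T̃ab = not-injective (∧-conicalʳ _ _ SabT̃ab)
    v≢w : v ≢ w
    v≢w refl = true≢false (trans (sym T̃vw) (llT̃ v))
    a≢b : a ≢ b
    a≢b refl = true≢false (trans (sym (proj₁ trav)) (llT a))

  towards : ∀ {v w} → T̃ v w ≡ true → T v w ≡ false → StepTowards v w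
  towards {v} {w} T̃vw Tvw with proj₂ (proj₂ (proj₂ cutT)) v
  ... | C , C⇔ , _ with C w in Cw
  ...   | true = towardsWithinPart T̃vw Tvw (Equivalence.to (C⇔ w) Cw)
  ...   | false = towardsAcrossParts T̃vw Tvw λ v⇝w → true≢false (trans (sym (Equivalence.from (C⇔ w) v⇝w)) Cw)

-- Rooting T̃ and counting its parent edges missing from T

minimal : ∀ {P : ℕ → Set} → (∀ i → Dec (P i)) → ∀ {N} → P N → Σ ℕ λ i → P i × (∀ {j} → j < i → ¬ P j)
minimal P? {zero} p0 = 0 , p0 , λ ()
minimal P? {suc N} pN with P? 0
... | yes p0 = 0 , p0 , λ ()
... | no ¬p0 with minimal (λ i → P? (suc i)) pN
...   | i , pi , below = suc i , pi , λ { {zero} _ → ¬p0 ; {suc j} (s≤s j<i) → below j<i }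

module _ {n : ℕ} where

  record ParentMap (E : EdgeSet n) (r : Fin n) : Set where
    field
      parent : Fin n → Fin n
      depth : Fin n → ℕ
      parent-edge : ∀ x → x ≢ r → E x (parent x) ≡ true
      parent-depth : ∀ x → x ≢ r → depth (parent x) < depth x

    ContainsParents : EdgeSet n → Set
    ContainsParents X = ∀ x → x ≢ r → X x (parent x) ≡ true

    reachRoot : ∀ {X} → ContainsParents X → ∀ x → Reach X x r
    reachRoot {X} hasX x = go x (<-wellFounded (depth x))
      where
      go : ∀ x → Acc _<_ (depth x) → Reach X x r
      go x (acc rs) with x ≟ r
      ... | yes refl = Reach-refl
      ... | no x≢r = Reach-trans (Reach-edge (hasX x x≢r)) (go (parent x) (rs (parent-depth x x≢r)))

    -- Removing an edge xy of X that is missing from Y keeps the parent edges, hence a path from x to y.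
    acyclic-⊆ : ∀ {X Y} → Symmetric X → Loopless X → Acyclic X → Symmetric Y →
                ContainsParents X → ContainsParents Y → X ⊆E Y
    acyclic-⊆ {X} {Y} symX llX acX symY hasX hasY x y Xxy with Y x y in Yxy
    ... | true = refl
    ... | false = contradiction (CycleEdge⇒HasCycle symX llX (Xxy , x⇝y)) acX
      where
      hasX-xy : ContainsParents (remE x y X)
      hasX-xy z z≢r = remE⁺ X (hasX z z≢r) (edge≢nonEdge symY (hasY z z≢r) Yxy)
      x⇝y = Reach-trans (reachRoot hasX-xy x) (Reach-sym (remE-sym x y symX) (reachRoot hasX-xy y))

  module _ (E : EdgeSet n) (r : Fin n) where

    Within : ℕ → Fin n → Set
    Within zero x = x ≡ r
    Within (suc i) x = Within i x ⊎ Σ (Fin n) λ y → E x y ≡ true × Within i y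

    within? : ∀ i x → Dec (Within i x)
    within? zero x = x ≟ r
    within? (suc i) x = within? i x ⊎-dec any? λ y → (E x y Bool.≟ true) ×-dec within? i y

    Walk⇒Within : ∀ {x vs} → WalkE E x r vs → Within (length vs) x
    Walk⇒Within here = inj₁ refl
    Walk⇒Within (step {w = y} e W) = inj₂ (y , e , Walk⇒Within W)

    -- The depth of x is its distance to r, and a parent is a neighbour one step closer.
    parentMap : Connected E → ParentMap E r
    parentMap connE = record
      { parent = parent ; depth = depth ; parent-edge = parent-edge ; parent-depth = parent-depth }
      where
      nearest : ∀ x → Σ ℕ λ i → Within i x × (∀ {j} → j < i → ¬ Within j x)
      nearest x = minimal (λ i → within? i x) (Walk⇒Within (proj₂ (connE x r)))
      depth : Fin n → ℕ
      depth x = proj₁ (nearest x)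
      closer : ∀ x → x ≢ r → Σ (Fin n) λ y → E x y ≡ true × depth y < depth x
      closer x x≢r with nearest x
      ... | zero , x≡r , _ = contradiction x≡r x≢r
      ... | suc j , inj₁ within-j , below = contradiction within-j (below ≤-refl)
      ... | suc j , inj₂ (y , e , within-j) , _ =
        y , e , s≤s (≮⇒≥ λ j<depth-y → proj₂ (proj₂ (nearest y)) j<depth-y within-j)
      parent : Fin n → Fin n
      parent x with x ≟ r
      ... | yes _ = r
      ... | no x≢r = proj₁ (closer x x≢r)
      parent-edge : ∀ x → x ≢ r → E x (parent x) ≡ true
      parent-edge x x≢r with x ≟ r
      ... | yes x≡r = contradiction x≡r x≢r
      ... | no x≢r = proj₁ (proj₂ (closer x x≢r))
      parent-depth : ∀ x → x ≢ r → depth (parent x) < depth x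
      parent-depth x x≢r with x ≟ r
      ... | yes x≡r = contradiction x≡r x≢r
      ... | no x≢r = proj₂ (proj₂ (closer x x≢r))

∈-tabulate-does : ∀ {n} {P : Fin n → Set} (P? : ∀ x → Dec (P x)) {x} → x ∈ₛ tabulate (does ∘ P?) ⇔ P x
∈-tabulate-does P? {x} = mk⇔
  (λ x∈ → does⇒ (P? x) (trans (sym (lookup∘tabulate (does ∘ P?) x)) ([]=⇒lookup x∈)))
  (λ px → lookup⇒[]= x _ (trans (lookup∘tabulate (does ∘ P?) x) (dec-true (P? x) px)))

module Convergence {n : ℕ} {G : EdgeSet n} (symG : Symmetric G) (llG : Loopless G) {p : Fin n → ℚ} {k : ℕ}
  {T̃ : EdgeSet n} (T̃∈B0 : B0 G p k T̃) (r : Fin n) where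

  private
    symT̃ = proj₁ (proj₁ T̃∈B0)
    llT̃ = ⊆-loopless (proj₁ (proj₂ (proj₁ T̃∈B0))) llG
    connT̃ = proj₁ (proj₂ (proj₂ (proj₁ T̃∈B0)))
    acT̃ = proj₂ (proj₂ (proj₂ (proj₁ T̃∈B0)))

  open ParentMap (parentMap T̃ r connT̃)

  MissingParent : EdgeSet n → Fin n → Set
  MissingParent T x = x ≢ r × T x (parent x) ≡ false

  missingParent? : ∀ T x → Dec (MissingParent T x)
  missingParent? T x = ¬? (x ≟ r) ×-dec T x (parent x) Bool.≟ false

  missing : EdgeSet n → Subset n
  missing T = tabulate (does ∘ missingParent? T)

  ∈-missing : ∀ T {x} → x ∈ₛ missing T ⇔ MissingParent T x
  ∈-missing T = ∈-tabulate-does (missingParent? T)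

  ∣missing∣<n : ∀ T → ∣ missing T ∣ < n
  ∣missing∣<n T = subst (∣ missing T ∣ <_) (∣⊤∣≡n n) (p⊂q⇒∣p∣<∣q∣ ((λ _ → ∈⊤) , r , ∈⊤ , r∉missing))
    where
    r∉missing : r ∉ₛ missing T
    r∉missing r∈ = proj₁ (Equivalence.to (∈-missing T) r∈) refl

  noneMissing⇒≈ : ∀ {T} → SpanningTree G T → Empty (missing T) → T ≈E T̃
  noneMissing⇒≈ {T} (symT , T⊆G , _ , acT) none = ⊆-antisym
    (acyclic-⊆ symT (⊆-loopless T⊆G llG) acT symT̃ hasT parent-edge)
    (acyclic-⊆ symT̃ llT̃ acT̃ symT parent-edge hasT)
    where
    hasT : ContainsParents T
    hasT x x≢r with T x (parent x) in Txp
    ... | true = refl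
    ... | false = contradiction (x , Equivalence.from (∈-missing T) (x≢r , Txp)) none

  reaches : ∀ T (T∈B0 : B0 G p k T) → SamePartition G p k T T̃ T∈B0 T̃∈B0 →
            Σ ℕ λ m → m ≤ ∣ missing T ∣ × BUDSteps G p k m T T̃
  reaches T T∈B0 same = go T T∈B0 same (<-wellFounded ∣ missing T ∣)
    where
    go : ∀ T (T∈B0 : B0 G p k T) → SamePartition G p k T T̃ T∈B0 T̃∈B0 → Acc _<_ ∣ missing T ∣ →
         Σ ℕ λ m → m ≤ ∣ missing T ∣ × BUDSteps G p k m T T̃
    go T T∈B0 same (acc rs) with nonempty? (missing T)
    ... | no none = 0 , z≤n , done (noneMissing⇒≈ (proj₁ T∈B0) none)
    ... | yes (x , x∈) =
      let (m , m≤ , steps) = go T′ T′∈B0 samePartition′ (rs shrinks) in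
      suc m , ≤-trans (s≤s m≤) shrinks , next budStep steps
      where
      x≢r = proj₁ (Equivalence.to (∈-missing T) x∈)
      Txp = proj₂ (Equivalence.to (∈-missing T) x∈)
      open Towards.StepTowards (Towards.towards symG llG {p} {k} T∈B0 T̃∈B0 same (parent-edge x x≢r) Txp)
      shrinks : ∣ missing T′ ∣ < ∣ missing T ∣
      shrinks = p⊂q⇒∣p∣<∣q∣ (stillMissing , x , x∈ , x∉missing′)
        where
        x∉missing′ : x ∉ₛ missing T′
        x∉missing′ x∈′ = true≢false (trans (sym gains) (proj₂ (Equivalence.to (∈-missing T′) x∈′)))
        stillMissing : missing T′ ⊆ₛ missing T
        stillMissing {y} y∈′ with Equivalence.to (∈-missing T′) y∈′
        ... | y≢r , T′yp = Equivalence.from (∈-missing T) (y≢r , wasMissing)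
          where
          wasMissing : T y (parent y) ≡ false
          wasMissing with T y (parent y) in Typ
          ... | true = contradiction (trans (sym (keeps y (parent y) Typ (parent-edge y y≢r))) T′yp) true≢false
          ... | false = refl

lemma3p3 : (n : ℕ) (G : EdgeSet n) → Symmetric G → Loopless G → Connected G →
    (p : Fin n → ℚ) → (∀ v → 0ℚ ℚ.< p v) → (k : ℕ) → 2 ≤ k →
    (T T̃ : EdgeSet n) (b : B0 G p k T) (b̃ : B0 G p k T̃) → SamePartition G p k T T̃ b b̃ →
    Σ ℕ λ m → m ≤ n ∸ 1 × BUDSteps G p k m T T̃
lemma3p3 zero G symG llG _ p _ k _ T T̃ b b̃ same = 0 , z≤n , done λ ()
lemma3p3 (suc n) G symG llG _ p _ k _ T T̃ b b̃ same =
  let (m , m≤missing , steps) = reaches T b same in m , ≤-trans m≤missing (≤-pred (∣missing∣<n T)) , steps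
  where open Convergence symG llG {p} {k} b̃ zero
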